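{- Let $G$ be a semi-balanced digraph without multiple edges, with a ribbon structure, a basis $(b_0,b_0b_1)$, and an arbitrary edge $\overrightarrow{uv}$ of $G$. Then the $\overrightarrow{uv}$-almost greedy tree procedure described below outputs a subgraph $H$ that is a tree (not necessarily spanning).
   Context: A digraph is semi-balanced if on every cycle the numbers of edges pointing in the two cyclic directions are equal. Ribbon structure: for each vertex $x$ a cyclic order of the edges incident to $x$; $xy^+$ is the edge following $xy$ at $x$. Basis: a vertex $b_0$ and an edge $b_0b_1$ of $G$ incident to it. Greedy tree procedure: start with $H=\emptyset$ and current pair $(b_0,b_0b_1)$. If the current pair is $(h,ht)$ with $h$ the head of the edge: if $(t,th)$ has not yet been current, include the edge into $H$ and let $(t,th^+)$ be next; otherwise do not include it and let $(h,ht^+)$ be next. If the current pair is $(t,th)$ with $t$ the tail: if $(h,ht)$ has not yet been current, do not include the edge and let $(t,th^+)$ be next; if $(h,ht)$ has already been current, let $(h,ht^+)$ be next. Stop when some node-edge pair becomes current for the second time; output $H$. The $\overrightarrow{uv}$-almost greedy procedure is identical, except that if $(u,uv)$ becomes current before $(v,vu)$, then at that moment the edge $uv$ is included into $H$ and $(v,vu^+)$ becomes the next current pair. -}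

module Defs where

open import Data.Nat using (ℕ; zero; suc; _+_; _%_)
open import Data.Nat.DivMod using (m%n<n)
open import Data.Fin using (Fin; toℕ; fromℕ<; _≟_)
open import Data.Bool using (Bool; true; false; not; if_then_else_; _∧_)
open import Data.Product using (Σ; ∃; _×_; _,_)
open import Data.Sum using (_⊎_)
open import Relation.Nullary using (¬_)
open import Relation.Nullary.Decidable using (⌊_⌋)
open import Relation.Binary.PropositionalEquality using (_≡_)
open import Function.Definitions using (Injective)

record Digraph (n m : ℕ) : Set where
  field
    tail : Fin m → Fin n
    head : Fin m → Fin n
open Digraph public

Inc : ∀ {n m} → Digraph n m → Fin n → Fin m → Set
Inc G x e = tail G e ≡ x ⊎ head G e ≡ x

NoMultipleEdges : ∀ {n m} → Digraph n m → Set
NoMultipleEdges {m = m} G =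
  (e f : Fin m) → tail G e ≡ tail G f → head G e ≡ head G f → e ≡ f

cnext : ∀ {k} → Fin (suc k) → Fin (suc k)
cnext {k} i = fromℕ< (m%n<n (suc (toℕ i)) (suc k))

countTrue : ∀ {k} → (Fin k → Bool) → ℕ
countTrue {zero} d = zero
countTrue {suc k} d = (if d Fin.zero then 1 else 0) + countTrue (λ i → d (Fin.suc i))

Traverses : ∀ {n m} → Digraph n m → Fin m → Bool → Fin n → Fin n → Set
Traverses G e true  x y = tail G e ≡ x × head G e ≡ y
Traverses G e false x y = head G e ≡ x × tail G e ≡ y

record Cycle {n m : ℕ} (G : Digraph n m) : Set where
  field
    len  : ℕ                         -- the cycle has  suc len  edges
    vtx  : Fin (suc len) → Fin n
    edge : Fin (suc len) → Fin m
    dir  : Fin (suc len) → Bool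
    vtx-inj  : Injective _≡_ _≡_ vtx
    edge-inj : Injective _≡_ _≡_ edge
    joins : ∀ i → Traverses G (edge i) (dir i) (vtx i) (vtx (cnext i))
open Cycle public

SemiBalanced : ∀ {n m} → Digraph n m → Set
SemiBalanced G = (c : Cycle G) → countTrue (dir c) ≡ countTrue (λ i → not (dir c i))

-- Ribbon structure: for each vertex x, rot x is the successor function of a
-- cyclic order on the edges incident to x  (xy⁺ = rot x (xy)).
-- A successor function of a cyclic order on a finite set is exactly a map of
-- the set into itself under which every element is reachable from every other.

iter : ∀ {A : Set} → (A → A) → ℕ → A → A
iter f zero a = a
iter f (suc j) a = f (iter f j a)

IsRibbon : ∀ {n m} → Digraph n m → (Fin n → Fin m → Fin m) → Set
IsRibbon {n} {m} G rot =
  ((x : Fin n) (e : Fin m) → Inc G x e → Inc G x (rot x e)) ×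
  ((x : Fin n) (e f : Fin m) → Inc G x e → Inc G x f →
     ∃ λ j → iter (rot x) j e ≡ f)

-- The uv-almost greedy tree procedure.
-- A node-edge pair (x , e) with x an endpoint of e.
-- State: running (visited pairs) H (current vertex) (current edge), or done H.

data State (n m : ℕ) : Set where
  running : (Fin n → Fin m → Bool) → (Fin m → Bool) → Fin n → Fin m → State n m
  done    : (Fin m → Bool) → State n m

module Procedure {n m : ℕ} (G : Digraph n m) (rot : Fin n → Fin m → Fin m)
                 (uv : Fin m) where

  eqF : ∀ {k} → Fin k → Fin k → Bool
  eqF a b = ⌊ a ≟ b ⌋

  other : Fin n → Fin m → Fin n
  other x e = if eqF x (head G e) then tail G e else head G e

  -- one step: (include e into H?, next vertex, next edge)
  decide : (Fin n → Fin m → Bool) → Fin n → Fin m → Bool × Fin n × Fin m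
  decide vis x e with eqF x (head G e)
  ... | true  = if not (vis (other x e) e)
                  then (true  , other x e , rot (other x e) e)
                  else (false , x , rot x e)
  ... | false = if not (vis (other x e) e)
                  then (if eqF e uv
                          -- almost-greedy modification: (u,uv) current before (v,vu)
                          then (true  , other x e , rot (other x e) e)
                          else (false , x , rot x e))
                  else (false , other x e , rot (other x e) e)

  addPair : (Fin n → Fin m → Bool) → Fin n → Fin m → (Fin n → Fin m → Bool)
  addPair vis x e y f = if eqF x y ∧ eqF e f then true else vis y f

  addEdge : (Fin m → Bool) → Fin m → (Fin m → Bool)
  addEdge H e f = if eqF e f then true else H f

  step : State n m → State n m
  step (done H) = done H
  step (running vis H x e) with decide vis x e
  ... | (inc , x' , e') =
        let H' = if inc then addEdge H e else H in
        if vis x' e'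
          then done H'                              -- a pair is current the 2nd time
          else running (addPair vis x' e') H' x' e'

  initial : Fin n → Fin m → State n m
  initial b₀ e₀ = running (addPair (λ _ _ → false) b₀ e₀) (λ _ → false) b₀ e₀

  Outputs : Fin n → Fin m → (Fin m → Bool) → Set
  Outputs b₀ e₀ H = ∃ λ k → iter step k (initial b₀ e₀) ≡ done H

-- Trees (subgraph given by an edge set S; its vertices are the endpoints
-- of its edges).

InV : ∀ {n m} → Digraph n m → (Fin m → Bool) → Fin n → Set
InV G S x = ∃ λ e → S e ≡ true × Inc G x e

data Walk {n m : ℕ} (G : Digraph n m) (S : Fin m → Bool) : Fin n → Fin n → Set where
  here : ∀ {x} → Walk G S x x
  next : ∀ {x y z} (e : Fin m) (d : Bool) → S e ≡ true → Traverses G e d x y →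
         Walk G S y z → Walk G S x z

IsTree : ∀ {n m} → Digraph n m → (Fin m → Bool) → Set
IsTree {n} G S =
  ((c : Cycle G) → ¬ (∀ i → S (edge c i) ≡ true)) ×
  ((x y : Fin n) → InV G S x → InV G S y → Walk G S x y)

{-# OPTIONS --safe #-}
-- The procedure walks around the ribbon graph like a depth-first search on node-edge pairs; every
-- step makes a new pair current until one recurs, so it halts. The tree edges on the path from the
-- current vertex back to b₀ (the stack) all point towards b₀, except possibly uv. An edge enters H
-- only when its far end has never been seen: a far end on the stack would close a cycle with at most
-- one backward edge, which semi-balance forces to be a pair of parallel edges; a far end seen but off
-- the stack has been left for good after a full turn of its cyclic order, so all its pairs are
-- visited. Hence every edge of H attaches a new vertex to the tree grown so far, and H stays
-- connected and acyclic.
module Submission where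

open import Defs
open import Data.Nat using (ℕ; zero; suc; pred; _+_; _*_; _≤_; _<_; z≤n; s≤s; s≤s⁻¹; _%_; _/_)
open import Data.Nat.Properties using (+-mono-≤; +-mono-≤-<; ≤-refl; ≤-reflexive; +-suc; +-identityʳ; +-monoˡ-≤; m≤n⇒m<n∨m≡n; <-≤-trans; ≤⇒≯; m≤n+m; module ≤-Reasoning)
open import Data.Nat.DivMod using (m≡m%n+[m/n]*n; m<n⇒m%n≡m; n%n≡0; m%n<n)
open import Data.Fin as Fin using (Fin; zero; suc; _≟_; toℕ; fromℕ; inject₁; combine; remQuot)
open import Data.Fin.Properties as Fin using (toℕ-fromℕ<; toℕ-injective; toℕ<n; toℕ-fromℕ; toℕ-inject₁; remQuot-combine; 0≢1+n)
open import Data.Bool using (Bool; true; false; not; if_then_else_; _∧_)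
open import Data.Bool.Properties using (¬-not; not-injective)
open import Data.Product using (Σ; ∃; ∃₂; _×_; _,_; proj₁; proj₂; uncurry)
open import Data.Sum using (_⊎_; inj₁; inj₂; [_,_]′)
open import Data.Empty using (⊥-elim)
open import Data.List using (List; []; _∷_; _++_; map; length; lookup)
open import Data.List.Properties using (map-++)
open import Data.List.Membership.Propositional using (_∈_; _∉_)
open import Data.List.Membership.Propositional.Properties using (∈-map⁺; ∈-lookup; ∈-++⁺ˡ; ∈-++⁺ʳ)
open import Data.List.Relation.Unary.Any using (here; there)
open import Data.List.Relation.Unary.All as All using (All; []; _∷_)
open import Data.List.Relation.Unary.All.Properties using (¬Any⇒All¬; All¬⇒¬Any; ++⁻ˡ)
open import Data.List.Relation.Unary.Unique.Propositional using (Unique; []; _∷_)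
open import Function using (_∘_; id)
open import Relation.Nullary using (¬_; yes; no; contradiction)
open import Relation.Binary.PropositionalEquality

iter-+ : ∀ {A : Set} (f : A → A) i j a → iter f (i + j) a ≡ iter f i (iter f j a)
iter-+ f zero    j a = refl
iter-+ f (suc i) j a = cong f (iter-+ f i j a)

iter-suc : ∀ {A : Set} (f : A → A) i a → iter f (suc i) a ≡ iter f i (f a)
iter-suc f zero    a = refl
iter-suc f (suc i) a = cong f (iter-suc f i a)

iter-periodic : ∀ {A : Set} (f : A → A) k a → iter f (suc k) a ≡ a →
                ∀ j → iter f j a ≡ iter f (j % suc k) a
iter-periodic f k a period j = begin
  iter f j a                                   ≡⟨ cong (λ i → iter f i a) (m≡m%n+[m/n]*n j (suc k)) ⟩
  iter f (j % suc k + j / suc k * suc k) a      ≡⟨ iter-+ f (j % suc k) _ a ⟩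
  iter f (j % suc k) (iter f (j / suc k * suc k) a) ≡⟨ cong (iter f (j % suc k)) (whole (j / suc k)) ⟩
  iter f (j % suc k) a                         ∎
  where
  open ≡-Reasoning
  whole : ∀ q → iter f (q * suc k) a ≡ a
  whole zero    = refl
  whole (suc q) = trans (iter-+ f (suc k) (q * suc k) a) (trans (cong (iter f (suc k)) (whole q)) period)

_⊆ᵇ_ : ∀ {A : Set} → (A → Bool) → (A → Bool) → Set
d ⊆ᵇ d′ = ∀ i → d i ≡ true → d′ i ≡ true

_⊆ₚ_ : ∀ {A B : Set} → (A → B → Bool) → (A → B → Bool) → Set
v ⊆ₚ v′ = ∀ x → v x ⊆ᵇ v′ x

indicator : Bool → ℕ
indicator b = if b then 1 else 0

indicator-mono : ∀ {b b′} → (b ≡ true → b′ ≡ true) → indicator b ≤ indicator b′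
indicator-mono {false} h = z≤n
indicator-mono {true}  h rewrite h refl = ≤-refl

countTrue-≤ : ∀ {k} (d : Fin k → Bool) → countTrue d ≤ k
countTrue-≤ {zero}  d = z≤n
countTrue-≤ {suc k} d = +-mono-≤ (indicator-mono {b′ = true} λ _ → refl) (countTrue-≤ (d ∘ suc))

countTrue-mono : ∀ {k} (d d′ : Fin k → Bool) → d ⊆ᵇ d′ → countTrue d ≤ countTrue d′
countTrue-mono {zero}  d d′ h = z≤n
countTrue-mono {suc k} d d′ h =
  +-mono-≤ (indicator-mono (h zero)) (countTrue-mono (d ∘ suc) (d′ ∘ suc) (h ∘ suc))

countTrue-mono-< : ∀ {k} (d d′ : Fin k → Bool) → d ⊆ᵇ d′ →
                   ∀ j → d j ≡ false → d′ j ≡ true → countTrue d < countTrue d′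
countTrue-mono-< {suc k} d d′ h zero dj d′j rewrite dj | d′j =
  s≤s (countTrue-mono (d ∘ suc) (d′ ∘ suc) (h ∘ suc))
countTrue-mono-< {suc k} d d′ h (suc j) dj d′j =
  +-mono-≤-< (indicator-mono (h zero)) (countTrue-mono-< (d ∘ suc) (d′ ∘ suc) (h ∘ suc) j dj d′j)

countTrue-complement : ∀ {k} (d : Fin k → Bool) → countTrue d + countTrue (λ i → not (d i)) ≡ k
countTrue-complement {zero}  d = refl
countTrue-complement {suc k} d with d zero | countTrue-complement (d ∘ suc)
... | true  | eq = cong suc eq
... | false | eq = trans (+-suc _ _) (cong suc eq)

countTrue-≡0 : ∀ {k} (d : Fin k → Bool) → (∀ i → d i ≡ false) → countTrue d ≡ 0
countTrue-≡0 {zero}  d h = refl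
countTrue-≡0 {suc k} d h rewrite h zero = countTrue-≡0 (d ∘ suc) (h ∘ suc)

countTrue-≤1 : ∀ {k} (d : Fin k → Bool) → (∀ {i j} → d i ≡ true → d j ≡ true → i ≡ j) → countTrue d ≤ 1
countTrue-≤1 {zero}  d u = z≤n
countTrue-≤1 {suc k} d u with d zero in d0
... | true  = ≤-reflexive (cong suc (countTrue-≡0 (d ∘ suc) λ i → ¬-not λ di → 0≢1+n (u d0 di)))
... | false = countTrue-≤1 (d ∘ suc) (λ di dj → Fin.suc-injective (u di dj))

module _ {n m : ℕ} where

  countPairs : (Fin n → Fin m → Bool) → ℕ
  countPairs v = countTrue (λ k → uncurry v (remQuot {n} m k))

  countPairs-≤ : (v : Fin n → Fin m → Bool) → countPairs v ≤ n * m
  countPairs-≤ v = countTrue-≤ _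

  countPairs-mono-< : (v v′ : Fin n → Fin m → Bool) → v ⊆ₚ v′ →
                      ∀ x e → v x e ≡ false → v′ x e ≡ true → countPairs v < countPairs v′
  countPairs-mono-< v v′ h x e vxe v′xe =
    countTrue-mono-< _ _ (λ k → h (proj₁ (remQuot {n} m k)) (proj₂ (remQuot {n} m k))) (combine x e)
      (subst (λ p → uncurry v p ≡ false) (sym (remQuot-combine {n} {m} x e)) vxe)
      (subst (λ p → uncurry v′ p ≡ true) (sym (remQuot-combine {n} {m} x e)) v′xe)

toℕ-cnext : ∀ {k} (i : Fin (suc k)) → toℕ (cnext i) ≡ suc (toℕ i) % suc k
toℕ-cnext {k} i = toℕ-fromℕ< (m%n<n (suc (toℕ i)) (suc k))

cnext-inject₁ : ∀ {k} (i : Fin k) → cnext (inject₁ i) ≡ suc i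
cnext-inject₁ {k} i = toℕ-injective (begin
  toℕ (cnext (inject₁ i))         ≡⟨ toℕ-cnext (inject₁ i) ⟩
  suc (toℕ (inject₁ i)) % suc k   ≡⟨ cong (λ j → suc j % suc k) (toℕ-inject₁ i) ⟩
  suc (toℕ i) % suc k             ≡⟨ m<n⇒m%n≡m (s≤s (toℕ<n i)) ⟩
  suc (toℕ i)                     ∎)
  where open ≡-Reasoning

cnext-fromℕ : ∀ k → cnext (fromℕ k) ≡ zero
cnext-fromℕ k = toℕ-injective (trans (toℕ-cnext (fromℕ k))
  (trans (cong (λ j → suc j % suc k) (toℕ-fromℕ k)) (n%n≡0 (suc k))))

cnext-surjective : ∀ {k} (i : Fin (suc k)) → ∃ λ p → cnext p ≡ i
cnext-surjective {k}     zero    = fromℕ k , cnext-fromℕ k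
cnext-surjective {suc k} (suc i) = inject₁ i , cnext-inject₁ i

fromℕ-or-inject₁ : ∀ {k} (i : Fin (suc k)) → i ≡ fromℕ k ⊎ ∃ λ j → i ≡ inject₁ j
fromℕ-or-inject₁ {zero}  zero    = inj₁ refl
fromℕ-or-inject₁ {suc k} zero    = inj₂ (zero , refl)
fromℕ-or-inject₁ {suc k} (suc i) with fromℕ-or-inject₁ i
... | inj₁ refl     = inj₁ refl
... | inj₂ (j , refl) = inj₂ (suc j , refl)

module _ {A B : Set} (f : A → B) where

  lookup-injective : ∀ {xs} → Unique (map f xs) → ∀ {i j} → f (lookup xs i) ≡ f (lookup xs j) → i ≡ j
  lookup-injective {x ∷ xs} (_ ∷ _)    {zero}  {zero}  eq = refl
  lookup-injective {x ∷ xs} (fx∉ ∷ _)  {zero}  {suc j} eq = contradiction eq (All.lookup fx∉ (∈-map⁺ f (∈-lookup j)))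
  lookup-injective {x ∷ xs} (fx∉ ∷ _)  {suc i} {zero}  eq = contradiction (sym eq) (All.lookup fx∉ (∈-map⁺ f (∈-lookup i)))
  lookup-injective {x ∷ xs} (_ ∷ u)    {suc i} {suc j} eq = cong suc (lookup-injective u eq)

module _ {A : Set} where

  Unique-++⁻ˡ : ∀ (xs : List A) {ys} → Unique (xs ++ ys) → Unique xs
  Unique-++⁻ˡ []       u         = []
  Unique-++⁻ˡ (x ∷ xs) (x∉ ∷ u) = ++⁻ˡ xs x∉ ∷ Unique-++⁻ˡ xs u

  Unique-++-∷⇒∉ : ∀ (xs : List A) {y ys} → Unique (xs ++ y ∷ ys) → y ∉ xs
  Unique-++-∷⇒∉ (x ∷ xs) (x∉ ∷ u) (here refl) = All.lookup x∉ (∈-++⁺ʳ xs (here refl)) refl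
  Unique-++-∷⇒∉ (x ∷ xs) (x∉ ∷ u) (there y∈) = Unique-++-∷⇒∉ xs u y∈

  Unique-∷ : ∀ {x : A} {xs} → x ∉ xs → Unique xs → Unique (x ∷ xs)
  Unique-∷ {xs = xs} x∉ u = ¬Any⇒All¬ xs x∉ ∷ u

module Graph {n m : ℕ} (G : Digraph n m) where

  Traverses-inc : ∀ {e d x y} → Traverses G e d x y → Inc G x e × Inc G y e
  Traverses-inc {d = true}  (t , h) = inj₁ t , inj₂ h
  Traverses-inc {d = false} (h , t) = inj₂ h , inj₁ t

  Traverses-flip : ∀ {e d x y} → Traverses G e d x y → Traverses G e (not d) y x
  Traverses-flip {d = true}  (t , h) = h , t
  Traverses-flip {d = false} (h , t) = t , h

  Traverses-endpoint : ∀ {e d x y w} → Traverses G e d x y → Inc G w e → w ≡ x ⊎ w ≡ y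
  Traverses-endpoint {d = true}  (t , h) (inj₁ t′) = inj₁ (trans (sym t′) t)
  Traverses-endpoint {d = true}  (t , h) (inj₂ h′) = inj₂ (trans (sym h′) h)
  Traverses-endpoint {d = false} (h , t) (inj₁ t′) = inj₂ (trans (sym t′) t)
  Traverses-endpoint {d = false} (h , t) (inj₂ h′) = inj₁ (trans (sym h′) h)

  Walk-mono : ∀ {S S′ x y} → S ⊆ᵇ S′ → Walk G S x y → Walk G S′ x y
  Walk-mono h here               = here
  Walk-mono h (next e d e∈ t w) = next e d (h e e∈) t (Walk-mono h w)

  _++ʷ_ : ∀ {S x y z} → Walk G S x y → Walk G S y z → Walk G S x z
  here              ++ʷ w′ = w′
  next e d e∈ t w ++ʷ w′ = next e d e∈ t (w ++ʷ w′)

  Walk-reverse : ∀ {S x y} → Walk G S x y → Walk G S y x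
  Walk-reverse here               = here
  Walk-reverse (next e d e∈ t w) = Walk-reverse w ++ʷ next e (not d) e∈ (Traverses-flip t) here

  cycle-loop : (c : Cycle G) → ∀ {i y x} → cnext i ≡ i → Inc G y (edge c i) → Inc G x (edge c i) → y ≡ x
  cycle-loop c {i} loop y∈ x∈ = same-ends (Traverses-endpoint (joins c i) y∈) (Traverses-endpoint (joins c i) x∈)
    where
    same-ends : ∀ {y x} → y ≡ vtx c i ⊎ y ≡ vtx c (cnext i) → x ≡ vtx c i ⊎ x ≡ vtx c (cnext i) → y ≡ x
    same-ends (inj₁ p) (inj₁ q) = trans p (sym q)
    same-ends (inj₁ p) (inj₂ q) = trans p (trans (cong (vtx c) (sym loop)) (sym q))
    same-ends (inj₂ p) (inj₁ q) = trans p (trans (cong (vtx c) loop) (sym q))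
    same-ends (inj₂ p) (inj₂ q) = trans p (sym q)

  cycle-neighbour : (c : Cycle G) → ∀ {i y} → cnext i ≢ i → Inc G y (edge c i) →
                    ∃ λ j → j ≢ i × Inc G y (edge c j)
  cycle-neighbour c {i} no-loop y∈ with Traverses-endpoint (joins c i) y∈
  ... | inj₂ refl = cnext i , no-loop , proj₁ (Traverses-inc (joins c (cnext i)))
  ... | inj₁ refl with cnext-surjective i
  ...   | p , refl = p , (λ p≡ → no-loop (cong cnext (sym p≡))) , proj₂ (Traverses-inc (joins c p))

  Acyclic : (Fin m → Bool) → Set
  Acyclic S = (c : Cycle G) → ¬ (∀ i → S (edge c i) ≡ true)

  Acyclic-extend : ∀ {S S′ e y x} → Acyclic S → (∀ g → g ≢ e → S′ g ≡ true → S g ≡ true) →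
                   Inc G y e → Inc G x e → y ≢ x → (∀ g → S g ≡ true → ¬ Inc G y g) → Acyclic S′
  Acyclic-extend {e = e} acyclic S′⊆ y∈ x∈ y≢x y∉S c all-S′
    with Fin.any? (λ i → edge c i Fin.≟ e)
  ... | no e∉c = acyclic c λ i → S′⊆ (edge c i) (λ i≡ → e∉c (i , i≡)) (all-S′ i)
  ... | yes (i , refl) with cnext i Fin.≟ i
  ...   | yes loop = y≢x (cycle-loop c loop y∈ x∈)
  ...   | no no-loop with cycle-neighbour c no-loop y∈
  ...     | j , j≢i , y∈j = y∉S (edge c j) (S′⊆ (edge c j) (λ ≡e → j≢i (edge-inj c ≡e)) (all-S′ j)) y∈j

  Step : Set
  Step = Fin n × Fin m × Bool

  source : Step → Fin n
  source = proj₁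

  edgeOf : Step → Fin m
  edgeOf s = proj₁ (proj₂ s)

  TraversesStep : Step → Fin n → Set
  TraversesStep (x , e , d) y = Traverses G e d x y

  infixr 5 _◅_
  data Path : Fin n → List Step → Fin n → Set where
    ε   : ∀ {x} → Path x [] x
    _◅_ : ∀ {x y z e d L} → Traverses G e d x y → Path y L z → Path x ((x , e , d) ∷ L) z

  vertices : Fin n → List Step → List (Fin n)
  vertices z []      = z ∷ []
  vertices z (s ∷ L) = source s ∷ vertices z L

  vertices-++ : ∀ z L₁ L₂ → vertices z (L₁ ++ L₂) ≡ map source L₁ ++ vertices z L₂
  vertices-++ z []       L₂ = refl
  vertices-++ z (s ∷ L₁) L₂ = cong (source s ∷_) (vertices-++ z L₁ L₂)

  vertices-head : ∀ {y L z} → Path y L z → ∃ λ ys → vertices z L ≡ y ∷ ys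
  vertices-head ε       = _ , refl
  vertices-head (t ◅ p) = _ , refl

  Path-split : ∀ {x L z y} → Path x L z → y ∈ vertices z L →
               ∃₂ λ L₁ L₂ → L ≡ L₁ ++ L₂ × Path x L₁ y × Path y L₂ z
  Path-split ε       (here refl) = [] , [] , refl , ε , ε
  Path-split (t ◅ p) (here refl) = [] , _ , refl , ε , t ◅ p
  Path-split (t ◅ p) (there y∈) with Path-split p y∈
  ... | L₁ , L₂ , refl , p₁ , p₂ = _ ∷ L₁ , L₂ , refl , t ◅ p₁ , p₂

  Path-inner : ∀ {x s L z} → Path x (s ∷ L) z → (j : Fin (length L)) →
               TraversesStep (lookup (s ∷ L) (inject₁ j)) (source (lookup L j))
  Path-inner (t ◅ t′ ◅ p) zero    = t
  Path-inner (t ◅ t′ ◅ p) (suc j) = Path-inner (t′ ◅ p) j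

  Path-last : ∀ {x s L z} → Path x (s ∷ L) z → TraversesStep (lookup (s ∷ L) (fromℕ (length L))) z
  Path-last (t ◅ ε)      = t
  Path-last (t ◅ t′ ◅ p) = Path-last (t′ ◅ p)

  Path-source : ∀ {x s L z} → Path x (s ∷ L) z → source s ≡ x
  Path-source (t ◅ p) = refl

  closedPath⇒Cycle : ∀ {x s L} → Path x (s ∷ L) x →
                     Unique (map source (s ∷ L)) → Unique (map edgeOf (s ∷ L)) →
                     Σ (Cycle G) λ c → ∀ i → (vtx c i , edge c i , dir c i) ∈ s ∷ L
  closedPath⇒Cycle {x} {s} {L} p uV uE = cycle , ∈-lookup
    where
    C = s ∷ L
    step-joins : ∀ i → TraversesStep (lookup C i) (source (lookup C (cnext i)))
    step-joins i with fromℕ-or-inject₁ i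
    step-joins i | inj₁ refl rewrite cnext-fromℕ (length L) =
      subst (TraversesStep (lookup C i)) (sym (Path-source p)) (Path-last p)
    step-joins i | inj₂ (j , refl) rewrite cnext-inject₁ j = Path-inner p j
    cycle : Cycle G
    cycle = record
      { len      = length L
      ; vtx      = λ i → source (lookup C i)
      ; edge     = λ i → edgeOf (lookup C i)
      ; dir      = λ i → proj₂ (proj₂ (lookup C i))
      ; vtx-inj  = lookup-injective source uV
      ; edge-inj = lookup-injective edgeOf uE
      ; joins    = step-joins
      }

module _ {n m : ℕ} {G : Digraph n m} (semiBalanced : SemiBalanced G) (simple : NoMultipleEdges G) (uv : Fin m) where

  BackwardOnly : Cycle G → Set
  BackwardOnly c = ∀ i → dir c i ≡ false → edge c i ≡ uv

  -- semi-balance makes the length even, i.e. twice the number of backward edges, which is at most one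
  BackwardOnly⇒len≡1 : (c : Cycle G) → BackwardOnly c → len c ≡ 1
  BackwardOnly⇒len≡1 c only-uv = half backward backward≤1 (begin
    suc (len c)                                 ≡⟨ countTrue-complement (dir c) ⟨
    countTrue (dir c) + backward                ≡⟨ cong (_+ backward) (semiBalanced c) ⟩
    backward + backward                         ∎)
    where
    open ≡-Reasoning
    backward = countTrue (λ i → not (dir c i))
    backward≤1 : backward ≤ 1
    backward≤1 = countTrue-≤1 _ λ di dj →
      edge-inj c (trans (only-uv _ (not-injective di)) (sym (only-uv _ (not-injective dj))))
    half : ∀ b → b ≤ 1 → suc (len c) ≡ b + b → len c ≡ 1
    half 0             _         ()
    half 1             _         eq = cong pred eq
    half (suc (suc _)) (s≤s ()) _

  parallel : ∀ {e f x y} → tail G e ≡ x → head G e ≡ y → tail G f ≡ x → head G f ≡ y → e ≡ f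
  parallel te he tf hf = simple _ _ (trans te (sym tf)) (trans he (sym hf))

  len≡1⇒¬BackwardOnly : (c : Cycle G) → len c ≡ 1 → ¬ BackwardOnly c
  len≡1⇒¬BackwardOnly c@record { len = suc zero ; dir = d ; edge = e ; edge-inj = inj ; joins = j } refl only-uv
    with d zero | d (suc zero) | j zero | j (suc zero) | semiBalanced c | only-uv zero | only-uv (suc zero)
  ... | true  | true  | _         | _         | () | _  | _
  ... | false | false | _         | _         | _  | u₀ | u₁ = 0≢1+n (inj (trans (u₀ refl) (sym (u₁ refl))))
  ... | true  | false | (t₀ , h₀) | (h₁ , t₁) | _  | _  | _  = 0≢1+n (inj (parallel t₀ h₀ t₁ h₁))
  ... | false | true  | (h₀ , t₀) | (t₁ , h₁) | _  | _  | _  = 0≢1+n (inj (parallel t₀ h₀ t₁ h₁))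

  ¬BackwardOnly : (c : Cycle G) → ¬ BackwardOnly c
  ¬BackwardOnly c only-uv = len≡1⇒¬BackwardOnly c (BackwardOnly⇒len≡1 c only-uv) only-uv

module AlmostGreedy {n m : ℕ} (G : Digraph n m) (semiBalanced : SemiBalanced G) (simple : NoMultipleEdges G)
                    (rot : Fin n → Fin m → Fin m) (ribbon : IsRibbon G rot) (b₀ : Fin n) (e₀ : Fin m) (uv : Fin m) where

  open Graph G
  open import Data.List.Membership.DecPropositional (Fin._≟_ {n}) using (_∈?_)
  open Procedure G rot uv

  Visited : Set
  Visited = Fin n → Fin m → Bool

  Seen : Visited → Fin n → Set
  Seen vis x = ∃ λ e → vis x e ≡ true

  eqF-≡ : ∀ {k} {a b : Fin k} → a ≡ b → eqF a b ≡ true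
  eqF-≡ {a = a} {b} a≡b with a ≟ b
  ... | yes _   = refl
  ... | no a≢b = contradiction a≡b a≢b

  eqF-≢ : ∀ {k} {a b : Fin k} → a ≢ b → eqF a b ≡ false
  eqF-≢ {a = a} {b} a≢b with a ≟ b
  ... | yes a≡b = contradiction a≡b a≢b
  ... | no _    = refl

  addPair-self : ∀ vis x e → addPair vis x e x e ≡ true
  addPair-self vis x e rewrite eqF-≡ {a = x} refl | eqF-≡ {a = e} refl = refl

  addPair-⊇ : ∀ vis x e → vis ⊆ₚ addPair vis x e
  addPair-⊇ vis x e y f vyf with eqF x y ∧ eqF e f
  ... | true  = refl
  ... | false = vyf

  addPair-inv : ∀ vis x e y f → addPair vis x e y f ≡ true → (x ≡ y × e ≡ f) ⊎ vis y f ≡ true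
  addPair-inv vis x e y f v′ with x ≟ y | e ≟ f
  ... | yes x≡y | yes e≡f = inj₁ (x≡y , e≡f)
  ... | yes _   | no _    = inj₂ v′
  ... | no _    | _       = inj₂ v′

  Seen-addPair : ∀ vis x e y → Seen (addPair vis x e) y → x ≡ y ⊎ Seen vis y
  Seen-addPair vis x e y (f , v′) with addPair-inv vis x e y f v′
  ... | inj₁ (x≡y , _) = inj₁ x≡y
  ... | inj₂ v         = inj₂ (f , v)

  addEdge-self : ∀ H e → addEdge H e e ≡ true
  addEdge-self H e rewrite eqF-≡ {a = e} refl = refl

  addEdge-⊇ : ∀ H e f → H f ≡ true → addEdge H e f ≡ true
  addEdge-⊇ H e f Hf with eqF e f
  ... | true  = refl
  ... | false = Hf

  addEdge-inv : ∀ H e f → f ≢ e → addEdge H e f ≡ true → H f ≡ true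
  addEdge-inv H e f f≢e H′f rewrite eqF-≢ (λ e≡f → f≢e (sym e≡f)) = H′f

  Arc : Visited → Fin n → Fin m → Fin m → Set
  Arc vis w f c = ∃ λ k → (∀ j → j ≤ k → vis w (iter (rot w) j (rot w f)) ≡ true) × iter (rot w) k (rot w f) ≡ c

  Arc-mono : ∀ {vis vis′ w f c} → vis ⊆ₚ vis′ → Arc vis w f c → Arc vis′ w f c
  Arc-mono vis⊆ (k , visited , end) = k , (λ j j≤k → vis⊆ _ _ (visited j j≤k)) , end

  Arc-start : ∀ {vis w f} → vis w (rot w f) ≡ true → Arc vis w f (rot w f)
  Arc-start v = 0 , (λ { zero _ → v }) , refl

  Arc-extend : ∀ {vis w f c} → Arc vis w f c → vis w (rot w c) ≡ true → Arc vis w f (rot w c)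
  Arc-extend {vis} {w} {f} {c} (k , visited , refl) v = suc k , visited′ , refl
    where
    visited′ : ∀ j → j ≤ suc k → vis w (iter (rot w) j (rot w f)) ≡ true
    visited′ j j≤ with m≤n⇒m<n∨m≡n j≤
    ... | inj₁ j<  = visited j (s≤s⁻¹ j<)
    ... | inj₂ refl = v

  -- an arc that has come round to f is a full period of rot w, which covers every edge at w
  Arc-complete : ∀ {vis w f} → Arc vis w f f → Inc G w f → ∀ g → Inc G w g → vis w g ≡ true
  Arc-complete {vis} {w} {f} (k , visited , end) w∈f g w∈g =
    subst (λ h → vis w h ≡ true) reaches
      (subst (λ h → vis w h ≡ true) (sym (iter-periodic (rot w) k z (cong (rot w) end) j))
        (visited (j % suc k) (s≤s⁻¹ (m%n<n j (suc k)))))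
    where
    z = rot w f
    w∈z : Inc G w z
    w∈z = proj₁ ribbon w f w∈f
    j = proj₁ (proj₂ ribbon w z g w∈z w∈g)
    reaches : iter (rot w) j z ≡ g
    reaches = proj₂ (proj₂ ribbon w z g w∈z w∈g)

  ForwardOrUV : Step → Set
  ForwardOrUV (_ , f , d) = d ≡ false → f ≡ uv

  -- Stack vis x c L: L is the tree path from the current vertex x back to b₀, c the current edge at x, and at
  -- each vertex w of the path all pairs from its tree edge f round to the edge at which w was left are visited.
  data Stack (vis : Visited) : Fin n → Fin m → List Step → Set where
    root  : ∀ {c} → vis b₀ e₀ ≡ true → Stack vis b₀ c []
    child : ∀ {w y f d c L} → Stack vis y f L → Traverses G f d w y → ForwardOrUV (w , f , d) →
            vis y f ≡ true → Arc vis w f c → Stack vis w c ((w , f , d) ∷ L)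

  below : List Step → List (Fin n)
  below []      = []
  below (_ ∷ L) = vertices b₀ L

  Stack-mono : ∀ {vis vis′ x c L} → vis ⊆ₚ vis′ → Stack vis x c L → Stack vis′ x c L
  Stack-mono vis⊆ (root v)               = root (vis⊆ _ _ v)
  Stack-mono vis⊆ (child s t fw v arc) = child (Stack-mono vis⊆ s) t fw (vis⊆ _ _ v) (Arc-mono vis⊆ arc)

  Stack-extend : ∀ {vis x c L} → Stack vis x c L → vis x (rot x c) ≡ true → Stack vis x (rot x c) L
  Stack-extend (root v)               _ = root v
  Stack-extend {vis} (child s t fw v arc) v′ = child s t fw v (Arc-extend {vis} arc v′)

  Stack-path : ∀ {vis x c L} → Stack vis x c L → Path x L b₀
  Stack-path (root _)             = ε
  Stack-path (child s t _ _ _) = t ◅ Stack-path s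

  Stack-forwardOrUV : ∀ {vis x c L} → Stack vis x c L → All ForwardOrUV L
  Stack-forwardOrUV (root _)              = []
  Stack-forwardOrUV (child s _ fw _ _) = fw ∷ Stack-forwardOrUV s

  Stack-vertices : ∀ {vis x c L} → Stack vis x c L → vertices b₀ L ≡ x ∷ below L
  Stack-vertices (root _)            = refl
  Stack-vertices (child _ _ _ _ _) = refl

  Stack-top∉below : ∀ {vis x c L} → Stack vis x c L → Unique (vertices b₀ L) → x ∉ below L
  Stack-top∉below (root _)          _         ()
  Stack-top∉below (child _ _ _ _ _) (x∉ ∷ _) = All¬⇒¬Any x∉

  Stack-top∈ : ∀ {vis x c L} → Stack vis x c L → x ∈ vertices b₀ L
  Stack-top∈ s rewrite Stack-vertices s = here refl

  Stack-below⊆ : ∀ {vis x c L w} → Stack vis x c L → w ∈ below L → w ∈ vertices b₀ L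
  Stack-below⊆ s w∈ rewrite Stack-vertices s = there w∈

  Stack-seen : ∀ {vis x c L w} → Stack vis x c L → w ∈ vertices b₀ L → Seen vis w
  Stack-seen (root v)                           (here refl) = e₀ , v
  Stack-seen (child s t fw v (k , visited , _)) (here refl) = _ , visited 0 z≤n
  Stack-seen (child s t fw v arc)               (there w∈) = Stack-seen s w∈

  Stack-edge : ∀ {vis x c L g} → Stack vis x c L → g ∈ map edgeOf L →
               ∃₂ λ w y → ∃ λ d → Traverses G g d w y × vis y g ≡ true × w ∈ vertices b₀ L × y ∈ below L
  Stack-edge {L = (w , _ , d) ∷ L} (child s t _ v _) (here refl) =
    w , _ , d , t , v , here refl , Stack-top∈ s
  Stack-edge (child s _ _ _ _) (there g∈) with Stack-edge s g∈
  ... | w , y , d , t , v , w∈ , y∈ = w , y , d , t , v , there w∈ , Stack-below⊆ s y∈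

  -- y on the stack would close a cycle whose only backward edge is uv
  Stack-closing-edge : ∀ {vis x c L y e d} → Stack vis x c L → Unique (vertices b₀ L) → Unique (map edgeOf L) →
                       Traverses G e d y x → ForwardOrUV (y , e , d) → e ∉ map edgeOf L → y ∉ vertices b₀ L
  Stack-closing-edge {y = y} {e} {d} s uV uE t fw e∉ y∈ with Path-split (Stack-path s) y∈
  ... | L₁ , L₂ , refl , p₁ , p₂ with vertices-head p₂
  ...   | ys , vs≡ with closedPath⇒Cycle (t ◅ p₁) (Unique-∷ (Unique-++-∷⇒∉ (map source L₁) uV′) (Unique-++⁻ˡ _ uV′))
                                                 (Unique-∷ (e∉ ∘ e∈L₁⇒e∈L) (Unique-++⁻ˡ _ uE′))
    where
    uV′ : Unique (map source L₁ ++ y ∷ ys)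
    uV′ = subst Unique (trans (vertices-++ b₀ L₁ L₂) (cong (map source L₁ ++_) vs≡)) uV
    uE′ : Unique (map edgeOf L₁ ++ map edgeOf L₂)
    uE′ = subst Unique (map-++ edgeOf L₁ L₂) uE
    e∈L₁⇒e∈L : e ∈ map edgeOf L₁ → e ∈ map edgeOf (L₁ ++ L₂)
    e∈L₁⇒e∈L e∈ = subst (e ∈_) (sym (map-++ edgeOf L₁ L₂)) (∈-++⁺ˡ e∈)
  ...     | c , steps∈ = ¬BackwardOnly semiBalanced simple uv c λ i → All.lookup forwardOrUV (steps∈ i)
    where
    forwardOrUV : All ForwardOrUV ((y , e , d) ∷ L₁)
    forwardOrUV = fw ∷ ++⁻ˡ L₁ (Stack-forwardOrUV s)

  -- an edge left out of H whose head pair was visited had its tail pair visited earlier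
  Skipped : Visited → (Fin m → Bool) → Fin n → Fin m → Set
  Skipped vis H x e = ∀ g → H g ≡ false → vis (head G g) g ≡ true →
                      (head G g ≡ x × g ≡ e) ⊎ (vis (tail G g) g ≡ true × (tail G g ≡ x → g ≢ e))

  Included : Visited → (Fin m → Bool) → List Step → Fin m → Set
  Included vis H L e = ∀ g → H g ≡ true →
                       g ∈ map edgeOf L ⊎ (vis (tail G g) g ≡ true × vis (head G g) g ≡ true × g ≢ e)

  Finished : Visited → List Step → Set
  Finished vis L = ∀ w → Seen vis w → w ∉ vertices b₀ L → ∀ g → Inc G w g → vis w g ≡ true

  record Invariant (vis : Visited) (H : Fin m → Bool) (x : Fin n) (e : Fin m) : Set where
    field
      stack           : List Step
      isStack         : Stack vis x e stack
      unique-vertices : Unique (vertices b₀ stack)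
      unique-edges    : Unique (map edgeOf stack)
      current         : vis x e ≡ true
      x∈e             : Inc G x e
      finished        : Finished vis stack
      skipped         : Skipped vis H x e
      included        : Included vis H stack e
      acyclic         : Acyclic H
      connected       : ∀ w → Seen vis w → Walk G H b₀ w

  visited-step : ∀ {vis x′ e′ y g} → vis x′ e′ ≡ false → vis y g ≡ true →
                 addPair vis x′ e′ y g ≡ true × (y ≡ x′ → g ≢ e′)
  visited-step {vis} {x′} {e′} new v = addPair-⊇ vis x′ e′ _ _ v , λ { refl refl → contradiction (trans (sym v) new) λ () }

  Skipped-step : ∀ {vis H H′ x e x′ e′} → H ⊆ᵇ H′ → vis x′ e′ ≡ false →
                 (head G e ≡ x → H′ e ≡ true ⊎ vis (tail G e) e ≡ true) →
                 Skipped vis H x e → Skipped (addPair vis x′ e′) H′ x′ e′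
  Skipped-step {vis} {H} {H′} {x} {e} {x′} {e′} H⊆H′ new current-ok skipped g H′g v′
    with addPair-inv vis x′ e′ (head G g) g v′
  ... | inj₁ (x′≡ , e′≡) = inj₁ (sym x′≡ , sym e′≡)
  ... | inj₂ v with skipped g (¬-not λ Hg → contradiction (trans (sym (H⊆H′ g Hg)) H′g) λ ()) v
  ...   | inj₂ (vt , _) = inj₂ (visited-step {vis} new vt)
  ...   | inj₁ (hx , refl) with current-ok hx
  ...     | inj₁ H′e = contradiction (trans (sym H′e) H′g) λ ()
  ...     | inj₂ vt  = inj₂ (visited-step {vis} new vt)

  both-visited-step : ∀ {vis x′ e′ g} → vis x′ e′ ≡ false → Inc G x′ e′ →
                      vis (tail G g) g ≡ true → vis (head G g) g ≡ true →
                      addPair vis x′ e′ (tail G g) g ≡ true × addPair vis x′ e′ (head G g) g ≡ true × g ≢ e′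
  both-visited-step {vis} {x′} {e′} {g} new x′∈e′ vt vh =
    proj₁ (kept vt) , proj₁ (kept vh) , λ { refl → [ proj₂ (kept vt) , proj₂ (kept vh) ]′ x′∈e′ refl }
    where
    kept : ∀ {y} → vis y g ≡ true → addPair vis x′ e′ y g ≡ true × (y ≡ x′ → g ≢ e′)
    kept = visited-step {vis} new

  Included-step : ∀ {vis H L e x′ e′} → vis x′ e′ ≡ false → Inc G x′ e′ →
                  Included vis H L e → Included (addPair vis x′ e′) H L e′
  Included-step {vis} new x′∈e′ included g Hg with included g Hg
  ... | inj₁ g∈              = inj₁ g∈
  ... | inj₂ (vt , vh , _) = inj₂ (both-visited-step {vis} new x′∈e′ vt vh)

  connected-step : ∀ {vis H x′ e′} → (∀ w → Seen vis w → Walk G H b₀ w) → Seen vis x′ →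
                   ∀ w → Seen (addPair vis x′ e′) w → Walk G H b₀ w
  connected-step {vis} {x′ = x′} {e′} connected seen w seen′ with Seen-addPair vis x′ e′ w seen′
  ... | inj₁ refl = connected x′ seen
  ... | inj₂ s    = connected w s

  module _ {vis H x e} (I : Invariant vis H x e) where
    open Invariant I

    H-seen : ∀ {g w} → H g ≡ true → Inc G w g → Seen vis w
    H-seen {g} Hg w∈g with included g Hg
    ... | inj₂ (vt , vh , _) = [ (λ { refl → _ , vt }) , (λ { refl → _ , vh }) ]′ w∈g
    ... | inj₁ g∈ with Stack-edge isStack g∈
    ...   | _ , _ , _ , t , _ , w′∈ , y′∈ with Traverses-endpoint t w∈g
    ...     | inj₁ refl = Stack-seen isStack w′∈
    ...     | inj₂ refl = Stack-seen isStack (Stack-below⊆ isStack y′∈)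

    isTree : IsTree G H
    isTree = acyclic , λ a b (_ , Ha , a∈) (_ , Hb , b∈) →
      Walk-reverse (connected a (H-seen Ha a∈)) ++ʷ connected b (H-seen Hb b∈)

    current-not-on-stack : ∀ {y d} → Traverses G e d y x → vis y e ≡ false → e ∉ map edgeOf stack
    current-not-on-stack t vy e∈ with Stack-edge isStack e∈
    ... | _ , y′ , _ , t′ , vy′ , _ , y′∈ with Traverses-endpoint t (proj₂ (Traverses-inc t′))
    ...   | inj₁ refl = contradiction (trans (sym vy′) vy) λ ()
    ...   | inj₂ refl = Stack-top∉below isStack unique-vertices y′∈

    fresh : ∀ {y d} → Traverses G e d y x → ForwardOrUV (y , e , d) → vis y e ≡ false → ¬ Seen vis y
    fresh {y} t fw vy seen with y ∈? vertices b₀ stack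
    ... | yes y∈ = Stack-closing-edge isStack unique-vertices unique-edges t fw (current-not-on-stack t vy) y∈
    ... | no y∉  = contradiction (trans (sym (finished y seen y∉ e (proj₁ (Traverses-inc t)))) vy) λ ()

    push : ∀ {y d} → Traverses G e d y x → ForwardOrUV (y , e , d) → vis y e ≡ false →
           Invariant (addPair vis y (rot y e)) (addEdge H e) y (rot y e)
    push {y} {d} t fw vy = record
      { stack           = (y , e , d) ∷ stack
      ; isStack         = child (Stack-mono grow isStack) t fw (grow x e current)
                                (Arc-start {addPair vis y (rot y e)} (addPair-self vis y (rot y e)))
      ; unique-vertices = Unique-∷ (y-fresh ∘ Stack-seen isStack) unique-vertices
      ; unique-edges    = Unique-∷ (current-not-on-stack t vy) unique-edges
      ; current         = addPair-self vis y (rot y e)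
      ; x∈e             = y∈rot
      ; finished        = finished′
      ; skipped         = Skipped-step {vis} (addEdge-⊇ H e) new (λ _ → inj₁ (addEdge-self H e)) skipped
      ; included        = included′
      ; acyclic         = Acyclic-extend acyclic (addEdge-inv H e) y∈e (proj₂ (Traverses-inc t))
                            (λ { refl → y-fresh (e , current) }) (λ g Hg y∈g → y-fresh (H-seen Hg y∈g))
      ; connected       = connected′
      }
      where
      grow = addPair-⊇ vis y (rot y e)
      y-fresh = fresh t fw vy
      y∈e = proj₁ (Traverses-inc t)
      y∈rot = proj₁ ribbon y e y∈e
      new : vis y (rot y e) ≡ false
      new = ¬-not λ v → y-fresh (_ , v)
      finished′ : Finished (addPair vis y (rot y e)) ((y , e , d) ∷ stack)
      finished′ w seen w∉ g w∈g with Seen-addPair vis y (rot y e) w seen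
      ... | inj₁ refl = contradiction (here refl) w∉
      ... | inj₂ seen′ = grow w g (finished w seen′ (w∉ ∘ there) g w∈g)
      included′ : Included (addPair vis y (rot y e)) (addEdge H e) ((y , e , d) ∷ stack) (rot y e)
      included′ g H′g with g Fin.≟ e
      ... | yes refl = inj₁ (here refl)
      ... | no g≢e with included g (addEdge-inv H e g g≢e H′g)
      ...   | inj₁ g∈ = inj₁ (there g∈)
      ...   | inj₂ (vt , vh , _) = inj₂ (both-visited-step {vis} new y∈rot vt vh)
      connected′ : ∀ w → Seen (addPair vis y (rot y e)) w → Walk G (addEdge H e) b₀ w
      connected′ w seen with Seen-addPair vis y (rot y e) w seen
      ... | inj₁ refl = Walk-mono (addEdge-⊇ H e) (connected x (e , current))
                          ++ʷ next e (not d) (addEdge-self H e) (Traverses-flip t) here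
      ... | inj₂ seen′ = Walk-mono (addEdge-⊇ H e) (connected w seen′)

    advance : vis x (rot x e) ≡ false → (head G e ≡ x → vis (tail G e) e ≡ true) →
              Invariant (addPair vis x (rot x e)) H x (rot x e)
    advance new tail-visited = record
      { stack           = stack
      ; isStack         = Stack-extend (Stack-mono grow isStack) (addPair-self vis x (rot x e))
      ; unique-vertices = unique-vertices
      ; unique-edges    = unique-edges
      ; current         = addPair-self vis x (rot x e)
      ; x∈e             = x∈rot
      ; finished        = finished′
      ; skipped         = Skipped-step {vis} (λ _ Hg → Hg) new (inj₂ ∘ tail-visited) skipped
      ; included        = Included-step {vis} new x∈rot included
      ; acyclic         = acyclic
      ; connected       = connected-step connected (e , current)
      }
      where
      grow = addPair-⊇ vis x (rot x e)
      x∈rot = proj₁ ribbon x e x∈e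
      finished′ : Finished (addPair vis x (rot x e)) stack
      finished′ w seen w∉ g w∈g with Seen-addPair vis x (rot x e) w seen
      ... | inj₁ refl  = contradiction (Stack-top∈ isStack) w∉
      ... | inj₂ seen′ = grow w g (finished w seen′ w∉ g w∈g)

    tail-current : x ≢ head G e → tail G e ≡ x
    tail-current x≢h = [ id , (λ h≡x → contradiction (sym h≡x) x≢h) ]′ x∈e

    current-on-stack : x ≢ head G e → vis (head G e) e ≡ true → e ∈ map edgeOf stack
    current-on-stack x≢h vh with H e in He
    ... | false with skipped e He vh
    ...   | inj₁ (h≡x , _) = contradiction (sym h≡x) x≢h
    ...   | inj₂ (_ , not-current) = contradiction refl (not-current (tail-current x≢h))
    current-on-stack x≢h vh | true with included e He
    ... | inj₁ e∈              = e∈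
    ... | inj₂ (_ , _ , e≢e) = contradiction refl e≢e

    pop : x ≢ head G e → vis (head G e) e ≡ true → vis (head G e) (rot (head G e) e) ≡ false →
          Invariant (addPair vis (head G e) (rot (head G e) e)) H (head G e) (rot (head G e) e)
    pop x≢h vh new = pop-stack isStack unique-vertices unique-edges finished included (current-on-stack x≢h vh)
      where
      h = head G e
      grow = addPair-⊇ vis h (rot h e)
      h∈rot = proj₁ ribbon h e (inj₂ refl)
      pop-stack : ∀ {L} → Stack vis x e L → Unique (vertices b₀ L) → Unique (map edgeOf L) →
                  Finished vis L → Included vis H L e → e ∈ map edgeOf L → Invariant (addPair vis h (rot h e)) H h (rot h e)
      pop-stack (child s _ _ _ _) (x∉ ∷ _) _ _ _ (there e∈) with Stack-edge s e∈
      ... | _ , _ , _ , t , _ , w∈ , y∈ with Traverses-endpoint t x∈e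
      ...   | inj₁ refl = ⊥-elim (All¬⇒¬Any x∉ w∈)
      ...   | inj₂ refl = ⊥-elim (All¬⇒¬Any x∉ (Stack-below⊆ s y∈))
      pop-stack (child {d = false} _ (h≡x , _) _ _ _) _ _ _ _ (here refl) = contradiction (sym h≡x) x≢h
      pop-stack {_ ∷ L} (child {d = true} s (t≡x , refl) _ _ arc) (_ ∷ uV) (_ ∷ uE) fin inc (here refl) = record
        { stack           = L
        ; isStack         = Stack-extend (Stack-mono grow s) (addPair-self vis h (rot h e))
        ; unique-vertices = uV
        ; unique-edges    = uE
        ; current         = addPair-self vis h (rot h e)
        ; x∈e             = h∈rot
        ; finished        = finished′
        ; skipped         = Skipped-step {vis} (λ _ Hg → Hg) new (λ h≡x → contradiction (sym h≡x) x≢h) skipped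
        ; included        = included′
        ; acyclic         = acyclic
        ; connected       = connected-step connected (e , vh)
        }
        where
        finished′ : Finished (addPair vis h (rot h e)) L
        finished′ w seen w∉ g w∈g with w Fin.≟ x
        ... | yes refl = grow w g (Arc-complete {vis} arc x∈e g w∈g)
        ... | no w≢x with Seen-addPair vis h (rot h e) w seen
        ...   | inj₁ refl  = contradiction (Stack-top∈ s) w∉
        ...   | inj₂ seen′ = grow w g (fin w seen′ (λ { (here w≡x) → w≢x w≡x ; (there w∈) → w∉ w∈ }) g w∈g)
        included′ : Included (addPair vis h (rot h e)) H L (rot h e)
        included′ g Hg with inc g Hg
        ... | inj₁ (here refl) = inj₂ (both-visited-step {vis} new h∈rot (subst (λ z → vis z e ≡ true) (sym t≡x) current) vh)
        ... | inj₁ (there g∈)  = inj₁ g∈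
        ... | inj₂ (vt , vh′ , _) = inj₂ (both-visited-step {vis} new h∈rot vt vh′)

  decide-head : ∀ {vis x e b} → x ≡ head G e → vis (tail G e) e ≡ b →
                decide vis x e ≡ (if not b then (true , tail G e , rot (tail G e) e) else (false , x , rot x e))
  decide-head {vis} {x} {e} x≡h vt rewrite eqF-≡ x≡h | eqF-≡ x≡h | vt = refl

  decide-tail : ∀ {vis x e b u} → x ≢ head G e → vis (head G e) e ≡ b → eqF e uv ≡ u →
                decide vis x e ≡ (if not b
                                    then (if u then (true , head G e , rot (head G e) e) else (false , x , rot x e))
                                    else (false , head G e , rot (head G e) e))
  decide-tail {vis} {x} {e} x≢h vh e≡uv rewrite eqF-≢ x≢h | eqF-≢ x≢h | vh | e≡uv = refl

  step-running : ∀ {vis H x e inc x′ e′ b} → decide vis x e ≡ (inc , x′ , e′) → vis x′ e′ ≡ b →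
                 step (running vis H x e) ≡ (if b then done (if inc then addEdge H e else H)
                                             else running (addPair vis x′ e′) (if inc then addEdge H e else H) x′ e′)
  step-running D v rewrite D | v = refl

  Halts : State n m → Set
  Halts s = Σ (Fin m → Bool) λ H → (∃ λ k → iter step k s ≡ done H) × IsTree G H

  Halts-step : ∀ s → Halts (step s) → Halts s
  Halts-step s (H , (k , ends) , tree) = H , (suc k , trans (iter-suc step k s) ends) , tree

  fuel-step : ∀ {vis x′ e′} fuel → n * m < countPairs vis + suc fuel → vis x′ e′ ≡ false →
              n * m < countPairs (addPair vis x′ e′) + fuel
  fuel-step {vis} {x′} {e′} fuel bound new = <-≤-trans bound (begin
    countPairs vis + suc fuel             ≡⟨ +-suc (countPairs vis) fuel ⟩
    suc (countPairs vis) + fuel           ≤⟨ +-monoˡ-≤ fuel grows ⟩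
    countPairs (addPair vis x′ e′) + fuel ∎)
    where
    open ≤-Reasoning
    grows = countPairs-mono-< vis _ (addPair-⊇ vis x′ e′) x′ e′ new (addPair-self vis x′ e′)

  Runs : ℕ → Set
  Runs fuel = ∀ {vis H x e} → Invariant vis H x e → n * m < countPairs vis + fuel → Halts (running vis H x e)

  step-to : ∀ {fuel vis H x e inc x′ e′} → Runs fuel → decide vis x e ≡ (inc , x′ , e′) →
            n * m < countPairs vis + suc fuel →
            (vis x′ e′ ≡ true → IsTree G (if inc then addEdge H e else H)) →
            (vis x′ e′ ≡ false → Invariant (addPair vis x′ e′) (if inc then addEdge H e else H) x′ e′) →
            Halts (running vis H x e)
  step-to {fuel} {vis} {H} {x} {e} {inc} {x′} {e′} run D bound tree invariant with vis x′ e′ in v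
  ... | true  = _ , (1 , step-running {vis} {H} {x} {e} {inc} {x′} {e′} D v) , tree refl
  ... | false = Halts-step _ (subst Halts (sym (step-running {vis} {H} {x} {e} {inc} {x′} {e′} D v))
                                           (run (invariant refl) (fuel-step {vis} fuel bound v)))

  run : ∀ fuel → Runs fuel
  run zero {vis} _ bound = contradiction (subst (n * m <_) (+-identityʳ _) bound) (≤⇒≯ (countPairs-≤ vis))
  run (suc fuel) {vis} {H} {x} {e} I bound with x Fin.≟ head G e
  ... | yes x≡h with vis (tail G e) e in vt
  ...   | false = step-to (run fuel) (decide-head x≡h vt) bound
                    (λ v → contradiction (_ , v) (fresh I {d = true} (refl , sym x≡h) (λ ()) vt))
                    (λ _ → push I {d = true} (refl , sym x≡h) (λ ()) vt)
  ...   | true  = step-to (run fuel) (decide-head x≡h vt) bound (λ _ → isTree I) (λ new → advance I new (λ _ → vt))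
  run (suc fuel) {vis} {H} {x} {e} I bound | no x≢h with vis (head G e) e in vh
  ...   | true  = step-to (run fuel) (decide-tail x≢h vh refl) bound (λ _ → isTree I) (pop I x≢h vh)
  ...   | false with e Fin.≟ uv
  ...     | yes e≡uv = step-to (run fuel) (decide-tail x≢h vh (eqF-≡ e≡uv)) bound
                         (λ v → contradiction (_ , v) (fresh I {d = false} t (λ _ → e≡uv) vh))
                         (λ _ → push I {d = false} t (λ _ → e≡uv) vh)
    where
    t : Traverses G e false (head G e) x
    t = refl , tail-current I x≢h
  ...     | no e≢uv  = step-to (run fuel) (decide-tail x≢h vh (eqF-≢ e≢uv)) bound (λ _ → isTree I)
                         (λ new → advance I new (λ h≡x → contradiction (sym h≡x) x≢h))

  only-b₀-seen : ∀ {w} → Seen (addPair (λ _ _ → false) b₀ e₀) w → b₀ ≡ w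
  only-b₀-seen {w} seen with Seen-addPair (λ _ _ → false) b₀ e₀ w seen
  ... | inj₁ b₀≡w = b₀≡w

  initial-invariant : Inc G b₀ e₀ → Invariant (addPair (λ _ _ → false) b₀ e₀) (λ _ → false) b₀ e₀
  initial-invariant b₀∈e₀ = record
    { stack           = []
    ; isStack         = root (addPair-self _ b₀ e₀)
    ; unique-vertices = [] ∷ []
    ; unique-edges    = []
    ; current         = addPair-self _ b₀ e₀
    ; x∈e             = b₀∈e₀
    ; finished        = λ w seen w∉ → contradiction (here (sym (only-b₀-seen seen))) w∉
    ; skipped         = λ g _ v → [ (λ (b₀≡ , e₀≡) → inj₁ (sym b₀≡ , sym e₀≡)) , (λ ()) ]′
                                      (addPair-inv _ b₀ e₀ _ g v)
    ; included        = λ _ ()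
    ; acyclic         = λ _ all → contradiction (all zero) λ ()
    ; connected       = λ w seen → subst (Walk G _ b₀) (only-b₀-seen seen) here
    }

lemma4p9 : ∀ {n m} (G : Digraph n m) → SemiBalanced G → NoMultipleEdges G →
           (rot : Fin n → Fin m → Fin m) → IsRibbon G rot →
           (b₀ : Fin n) (e₀ : Fin m) → Inc G b₀ e₀ →
           (uv : Fin m) →
           Σ (Fin m → Bool) λ H → Procedure.Outputs G rot uv b₀ e₀ H × IsTree G H
lemma4p9 {n} {m} G semiBalanced simple rot ribbon b₀ e₀ b₀∈e₀ uv =
  run (suc (n * m)) (initial-invariant b₀∈e₀) (m≤n+m (suc (n * m)) _)
  where open AlmostGreedy G semiBalanced simple rot ribbon b₀ e₀ uv
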